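{- Let $G=(V,E)$ be a graph whose edges are written as ordered pairs $\langle v_j,v_l\rangle$, let $S\subseteq V$ be a terminal set, $r\in S$ a root, $c:E\to\mathbb{Z}^{+}$ a cost function, $d:E\to\mathbb{Z}^{+}$ a delay function, and $D\in\mathbb{Z}^{+}$ a delay bound. Let $H$ be the auxiliary directed graph with terminal set $S_H$ constructed from these data as described in the context. Then, for every $C$, there exists a directed Steiner tree in $H$ rooted at $r$ spanning $S_H$ of minimum cost $C$ if and only if there exists a Steiner tree in $G$ spanning $S$ of minimum cost $C$ among Steiner trees in which the delay between $r$ and every terminal is at most $D$.
   Context: Construction of the auxiliary directed graph $H$ and its terminal set $S_H$: $H$ contains the vertex $r$, and $S_H$ initially equals $\{r\}$. For each $v_l\in V\setminus\{r\}$, $H$ contains $D$ vertices $v_l^{1},\dots,v_l^{D}$ (copies of $v_l$); if moreover $v_l\in S$, then $H$ also contains an additional vertex (also denoted $v_l$), which is added to $S_H$, together with arcs $\langle v_l^{i},v_l\rangle$ of cost $0$ for $i=1,\dots,D$. For each edge $e=\langle v_j,v_l\rangle\in E$ with $r\notin e$, $H$ contains the arcs $\langle v_j^{i},v_l^{d(e)+i}\rangle$ for $i=1,\dots,D-d(e)$, each of cost $c(e)$. For each edge $e=\langle r,v_l\rangle\in E$, $H$ contains the arc $\langle r,v_l^{d(e)}\rangle$ of cost $c(e)$ (when $d(e)\le D$). A directed Steiner tree in $H$ rooted at $r$ spanning $S_H$ is an out-arborescence in $H$ rooted at $r$ containing all vertices of $S_H$; its cost is the sum of its arc costs. A Steiner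 tree in $G$ spanning $S$ is a tree subgraph of $G$ containing all vertices of $S$; its cost is the sum of its edge costs, and the delay between $r$ and a vertex $v$ of the tree is the sum of the delays $d(e)$ over the edges $e$ of the unique tree path from $r$ to $v$. -}

module Defs where

open import Data.Nat using (ℕ; zero; suc; _+_; _≤_)
open import Data.Fin using (Fin; zero; suc)
open import Data.Fin.Subset using (Subset) renaming (_∈_ to _∈ₛ_)
open import Data.Vec using ([]; _∷_)
open import Data.Bool using (if_then_else_)
open import Data.List using (List; []; _∷_; map)
open import Data.Nat.ListAction using (sum)
open import Data.List.Membership.Propositional using (_∈_; _∉_)
open import Data.List.Relation.Unary.Unique.Propositional using (Unique)
open import Data.Product using (_×_; _,_; proj₁; proj₂; Σ; ∃)
open import Data.Sum using (_⊎_)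
open import Relation.Binary.PropositionalEquality using (_≡_; _≢_)
open import Relation.Nullary using (¬_)

Σsub : ∀ {m} → (Fin m → ℕ) → Subset m → ℕ
Σsub f [] = 0
Σsub f (b ∷ bs) = (if b then f zero else 0) + Σsub (λ i → f (suc i)) bs

record Network : Set where
  field
    n m  : ℕ
    ends : Fin m → Fin n × Fin n
    S    : Subset n
    r    : Fin n
    c    : Fin m → ℕ
    d    : Fin m → ℕ
    D    : ℕ

module _ (N : Network) where
  open Network N

  -- G is undirected: edge e joins u and w (in either written order).
  Joins : Fin m → Fin n → Fin n → Set
  Joins e u w = (ends e ≡ (u , w)) ⊎ (ends e ≡ (w , u))

  SimpleGraph : Set
  SimpleGraph = (∀ e → proj₁ (ends e) ≢ proj₂ (ends e))
              × (∀ e e' u w → Joins e u w → Joins e' u w → e ≡ e')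

  data Walk (F : Subset m) : Fin n → Fin n → Set where
    []   : ∀ {u} → Walk F u u
    step : ∀ {u w v} (e : Fin m) → e ∈ₛ F → Joins e u w → Walk F w v → Walk F u v

  walkVerts : ∀ {F u v} → Walk F u v → List (Fin n)
  walkVerts {u = u} []           = u ∷ []
  walkVerts {u = u} (step _ _ _ p) = u ∷ walkVerts p

  walkEdges : ∀ {F u v} → Walk F u v → List (Fin m)
  walkEdges []             = []
  walkEdges (step e _ _ p) = e ∷ walkEdges p

  IsPath : ∀ {F u v} → Walk F u v → Set
  IsPath p = Unique (walkVerts p)

  HasCycle : Subset m → Set
  HasCycle F = Σ (Fin n) λ u → Σ (Fin n) λ w → Σ (Walk F u w) λ p →
               IsPath p × (walkEdges p ≢ []) ×
               (Σ (Fin m) λ e → e ∈ₛ F × Joins e w u × e ∉ walkEdges p)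

  record SteinerTree : Set where
    field
      W : Subset n
      F : Subset m
      edgesInside : ∀ e → e ∈ₛ F → proj₁ (ends e) ∈ₛ W × proj₂ (ends e) ∈ₛ W
      connected   : ∀ u v → u ∈ₛ W → v ∈ₛ W → Σ (Walk F u v) IsPath
      acyclic     : ¬ HasCycle F
      spans       : ∀ v → v ∈ₛ S → v ∈ₛ W

  treeCost : SteinerTree → ℕ
  treeCost T = Σsub c (SteinerTree.F T)

  walkDelay : ∀ {F u v} → Walk F u v → ℕ
  walkDelay p = sum (map d (walkEdges p))

  DelayBounded : SteinerTree → Set
  DelayBounded T = ∀ v → v ∈ₛ S → (p : Walk (SteinerTree.F T) r v) → IsPath p →
                   walkDelay p ≤ D

  MinDelayBoundedSteinerCost : ℕ → Set
  MinDelayBoundedSteinerCost C =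
    Σ SteinerTree λ T → DelayBounded T × treeCost T ≡ C ×
      (∀ T' → DelayBounded T' → C ≤ treeCost T')

  -- raw vertices: r, copies v^i, terminal vertices v
  data HV : Set where
    root : HV
    cp   : Fin n → ℕ → HV
    tm   : Fin n → HV

  HArc : Set
  HArc = HV × HV × ℕ

  tl : HArc → HV
  tl (x , _ , _) = x

  hd : HArc → HV
  hd (_ , y , _) = y

  arcCost : HArc → ℕ
  arcCost (_ , _ , k) = k

  data IsArc : HArc → Set where
    termArc : ∀ v i → v ∈ₛ S → v ≢ r → 1 ≤ i → i ≤ D →
              IsArc (cp v i , tm v , 0)
    edgeArc : ∀ e u w i → Joins e u w → u ≢ r → w ≢ r → 1 ≤ i → i + d e ≤ D →
              IsArc (cp u i , cp w (d e + i) , c e)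
    rootArc : ∀ e w → Joins e r w → d e ≤ D →
              IsArc (root , cp w (d e) , c e)

  data Reach (A : List HArc) : HV → Set where
    here : Reach A root
    there : ∀ {x y k} → Reach A x → (x , y , k) ∈ A → Reach A y

  -- an out-arborescence in H rooted at r (vertex set = r plus heads of its arcs)
  -- containing all vertices of S_H = {r} ∪ (S ∖ {r})
  record DirSteinerTree : Set where
    field
      arcs      : List HArc
      areArcs   : ∀ a → a ∈ arcs → IsArc a
      rootIn0   : root ∉ map hd arcs
      inDeg1    : Unique (map hd arcs)
      reachable : ∀ a → a ∈ arcs → Reach arcs (hd a)
      spans     : ∀ v → v ∈ₛ S → v ≢ r → tm v ∈ map hd arcs

  dirCost : DirSteinerTree → ℕ
  dirCost T = sum (map arcCost (DirSteinerTree.arcs T))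

  MinDirSteinerCost : ℕ → Set
  MinDirSteinerCost C =
    Σ DirSteinerTree λ T → dirCost T ≡ C × (∀ T' → C ≤ dirCost T')

-- Both directions rest on one construction. Let U be a set of edges of G through which every
-- terminal is reached from r by a walk of delay at most D. Linking each vertex reached this way to
-- its predecessor on a walk of least delay dist v gives a tree of G: delays are positive, so dist
-- strictly increases along every link, which rules out cycles and makes the tree path from r to v
-- have delay exactly dist v ≤ D. The same tree, with each v ≠ r represented by its copy v^(dist v),
-- is an out-arborescence of H. Both trees cost at most c(U). A delay-bounded Steiner tree of G
-- provides such a U (its own edges), and so does a directed Steiner tree of H (the edges whose
-- copies are its arcs, a path to v^i in H being a walk of delay i in G; since G is simple distinct
-- edges have distinct copies). So each tree on one side is matched by a tree on the other side of
-- no larger cost, and the two minima coincide.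

module Submission where

open import Defs
open import Data.Nat using (ℕ; zero; suc; _+_; _∸_; _≤_; _<_; z≤n; s≤s; _≟_; _≤?_)
open import Data.Nat.Properties
open import Data.Nat.Induction using (<-rec)
open import Data.Nat.ListAction using (sum)
open import Data.Nat.ListAction.Properties using (sum-++; sum-↭)
open import Data.Fin using (Fin; zero; suc)
import Data.Fin.Properties as Fin
open import Data.Fin.Subset using (Subset) renaming (_∈_ to _∈ₛ_)
import Data.Fin.Subset.Properties as Subset
open import Data.Vec using ([]; _∷_; here; there; tabulate)
open import Data.Vec.Properties using (lookup∘tabulate; []=⇒lookup; lookup⇒[]=)
open import Data.Bool using (true; false)
open import Data.Maybe using (Maybe; just; nothing)
open import Data.Maybe.Properties using (just-injective)
open import Data.List using (List; []; _∷_; [_]; map; _++_; concatMap; allFin)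
open import Data.List.Properties using (map-++; map-∘; map-cong; map-concatMap)
open import Data.List.Membership.Propositional using (_∈_; _∉_; find; lose)
open import Data.List.Membership.Propositional.Properties
open import Data.List.Relation.Unary.Any using (here; there; any?)
open import Data.List.Relation.Unary.All using (All; []; _∷_)
import Data.List.Relation.Unary.All as All
open import Data.List.Relation.Unary.All.Properties using (¬Any⇒All¬)
open import Data.List.Relation.Unary.AllPairs using ([]; _∷_)
open import Data.List.Relation.Unary.Unique.Propositional using (Unique)
import Data.List.Relation.Unary.Unique.Propositional.Properties as Unique
import Data.List.Relation.Binary.Permutation.Propositional.Properties as Perm
open import Data.Product using (_×_; _,_; proj₁; proj₂; Σ)
import Data.Product.Properties as Product
open import Data.Sum using (_⊎_; inj₁; inj₂)
open import Data.Empty using (⊥; ⊥-elim)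
open import Data.Unit using (⊤; tt)
open import Function using (id; _∘_)
open import Relation.Binary.PropositionalEquality hiding ([_])
open import Relation.Nullary using (¬_; Dec; yes; no)
open import Relation.Nullary.Decidable using (isYes; map′; ¬?; _×-dec_; _⊎-dec_)

-- Finite sums and subsets

members : ∀ {k} → Subset k → List (Fin k)
members []           = []
members (true ∷ bs)  = zero ∷ map suc (members bs)
members (false ∷ bs) = map suc (members bs)

Σsub≡sum-members : ∀ {k} (f : Fin k → ℕ) (bs : Subset k) → Σsub f bs ≡ sum (map f (members bs))
Σsub≡sum-members f []           = refl
Σsub≡sum-members f (true ∷ bs)  =
  cong (f zero +_) (trans (Σsub≡sum-members (λ i → f (suc i)) bs) (cong sum (map-∘ (members bs))))
Σsub≡sum-members f (false ∷ bs) =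
  trans (Σsub≡sum-members (λ i → f (suc i)) bs) (cong sum (map-∘ (members bs)))

members-unique : ∀ {k} (bs : Subset k) → Unique (members bs)
members-unique []           = []
members-unique (true ∷ bs)  =
  ¬Any⇒All¬ _ zero∉ ∷ Unique.map⁺ Fin.suc-injective (members-unique bs)
  where
  zero∉ : zero ∉ map suc (members bs)
  zero∉ p with ∈-map⁻ suc p
  ... | _ , _ , ()
members-unique (false ∷ bs) = Unique.map⁺ Fin.suc-injective (members-unique bs)

∈ₛ⇒∈-members : ∀ {k} (bs : Subset k) {x} → x ∈ₛ bs → x ∈ members bs
∈ₛ⇒∈-members (true ∷ bs)  here      = here refl
∈ₛ⇒∈-members (true ∷ bs)  (there p) = there (∈-map⁺ suc (∈ₛ⇒∈-members bs p))
∈ₛ⇒∈-members (false ∷ bs) (there p) = ∈-map⁺ suc (∈ₛ⇒∈-members bs p)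

∈-members⇒∈ₛ : ∀ {k} (bs : Subset k) {x} → x ∈ members bs → x ∈ₛ bs
∈-members⇒∈ₛ (true ∷ bs) (here refl) = here
∈-members⇒∈ₛ (true ∷ bs) (there p) with ∈-map⁻ suc p
... | _ , q , refl = there (∈-members⇒∈ₛ bs q)
∈-members⇒∈ₛ (false ∷ bs) p with ∈-map⁻ suc p
... | _ , q , refl = there (∈-members⇒∈ₛ bs q)

isYes-true : ∀ {P : Set} (P? : Dec P) → P → isYes P? ≡ true
isYes-true (yes _) _  = refl
isYes-true (no ¬p) p = ⊥-elim (¬p p)

isYes-true⁻ : ∀ {P : Set} (P? : Dec P) → isYes P? ≡ true → P
isYes-true⁻ (yes p) _ = p

subsetOf : ∀ {k} {P : Fin k → Set} → (∀ x → Dec (P x)) → Subset k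
subsetOf P? = tabulate (λ x → isYes (P? x))

∈-subsetOf⁺ : ∀ {k} {P : Fin k → Set} (P? : ∀ x → Dec (P x)) {x} → P x → x ∈ₛ subsetOf P?
∈-subsetOf⁺ P? {x} px = lookup⇒[]= x _ (trans (lookup∘tabulate _ x) (isYes-true (P? x) px))

∈-subsetOf⁻ : ∀ {k} {P : Fin k → Set} (P? : ∀ x → Dec (P x)) {x} → x ∈ₛ subsetOf P? → P x
∈-subsetOf⁻ P? {x} p = isYes-true⁻ (P? x) (trans (sym (lookup∘tabulate _ x)) ([]=⇒lookup p))

sum-map-≤-injection : ∀ {A B : Set} (g : A → B) (h : A → ℕ) (f : B → ℕ) (xs : List A) (ys : List B) →
  Unique xs → (∀ {x} → x ∈ xs → g x ∈ ys) →
  (∀ {x y} → x ∈ xs → y ∈ xs → g x ≡ g y → x ≡ y) →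
  (∀ {x} → x ∈ xs → h x ≤ f (g x)) → sum (map h xs) ≤ sum (map f ys)
sum-map-≤-injection g h f []       ys _ _ _ _ = z≤n
sum-map-≤-injection g h f (x ∷ xs) ys (x∉xs ∷ uxs) g∈ g-inj h≤ with ∈-∃++ (g∈ (here refl))
... | ys₁ , ys₂ , refl = begin
  h x + sum (map h xs)               ≤⟨ +-mono-≤ (h≤ (here refl)) rest ⟩
  f (g x) + sum (map f (ys₁ ++ ys₂)) ≡⟨ sum-↭ (Perm.map⁺ f (Perm.shift (g x) ys₁ ys₂)) ⟨
  sum (map f (ys₁ ++ g x ∷ ys₂))     ∎
  where
  open ≤-Reasoning
  g∈′ : ∀ {y} → y ∈ xs → g y ∈ ys₁ ++ ys₂
  g∈′ {y} p with ∈-++⁻ ys₁ (g∈ (there p))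
  ... | inj₁ q         = ∈-++⁺ˡ q
  ... | inj₂ (here eq) = ⊥-elim (All.lookup x∉xs p (sym (g-inj (there p) (here refl) eq)))
  ... | inj₂ (there q) = ∈-++⁺ʳ ys₁ q
  rest : sum (map h xs) ≤ sum (map f (ys₁ ++ ys₂))
  rest = sum-map-≤-injection g h f xs (ys₁ ++ ys₂) uxs g∈′
           (λ p q → g-inj (there p) (there q)) (λ p → h≤ (there p))

concatMap-unique : ∀ {A B : Set} (hs : A → List B) (xs : List A) → Unique xs → (∀ x → Unique (hs x)) →
  (∀ {x x′ b} → b ∈ hs x → b ∈ hs x′ → x ≡ x′) → Unique (concatMap hs xs)
concatMap-unique hs []       _            _   _     = []
concatMap-unique hs (x ∷ xs) (x∉xs ∷ uxs) uhs owner =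
  Unique.++⁺ (uhs x) (concatMap-unique hs xs uxs uhs owner) disjoint
  where
  disjoint : ∀ {b} → b ∈ hs x × b ∈ concatMap hs xs → ⊥
  disjoint (p , q) with find (∈-concatMap⁻ hs {xs = xs} q)
  ... | x′ , x′∈ , q′ = All.lookup x∉xs x′∈ (owner p q′)

sum-map-concatMap : ∀ {A B : Set} (f : B → ℕ) (hs : A → List B) (xs : List A) →
  sum (map f (concatMap hs xs)) ≡ sum (map (λ x → sum (map f (hs x))) xs)
sum-map-concatMap f hs []       = refl
sum-map-concatMap f hs (x ∷ xs) = begin
  sum (map f (hs x ++ concatMap hs xs))            ≡⟨ cong sum (map-++ f (hs x) _) ⟩
  sum (map f (hs x) ++ map f (concatMap hs xs))    ≡⟨ sum-++ (map f (hs x)) _ ⟩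
  sum (map f (hs x)) + sum (map f (concatMap hs xs)) ≡⟨ cong (sum (map f (hs x)) +_) (sum-map-concatMap f hs xs) ⟩
  sum (map f (hs x)) + sum (map (λ x → sum (map f (hs x))) xs) ∎
  where open ≡-Reasoning

m≢n+m : ∀ m {n} → 1 ≤ n → m ≢ n + m
m≢n+m m 1≤n eq = <-irrefl eq (m<n+m m 1≤n)

least-≤? : (P : ℕ → Set) → (∀ k → Dec (P k)) → (D : ℕ) →
  (Σ ℕ λ k → k ≤ D × P k × (∀ j → j < k → ¬ P j)) ⊎ (∀ j → j ≤ D → ¬ P j)
least-≤? P P? D = search D 0 (+-identityʳ D) (λ _ ())
  where
  search : (t i : ℕ) → t + i ≡ D → (∀ j → j < i → ¬ P j) →
    (Σ ℕ λ k → k ≤ D × P k × (∀ j → j < k → ¬ P j)) ⊎ (∀ j → j ≤ D → ¬ P j)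
  search t i t+i≡D below with P? i
  ... | yes pi = inj₁ (i , subst (i ≤_) t+i≡D (m≤n+m i t) , pi , below)
  search zero    i i≡D below | no ¬pi = inj₂ λ j j≤D → upTo j (subst (j ≤_) (sym i≡D) j≤D)
    where
    upTo : ∀ j → j ≤ i → ¬ P j
    upTo j j≤i with m≤n⇒m<n∨m≡n j≤i
    ... | inj₁ j<i  = below j j<i
    ... | inj₂ refl = ¬pi
  search (suc t) i t+i≡D below | no ¬pi = search t (suc i) (trans (+-suc t i) t+i≡D) below′
    where
    below′ : ∀ j → j < suc i → ¬ P j
    below′ j (s≤s j≤i) with m≤n⇒m<n∨m≡n j≤i
    ... | inj₁ j<i  = below j j<i
    ... | inj₂ refl = ¬pi

IsMinimumOn : {A : Set} → (A → Set) → (A → ℕ) → ℕ → Set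
IsMinimumOn {A} P f C = Σ A λ x → P x × f x ≡ C × (∀ y → P y → C ≤ f y)

minimum-transfer : {A B : Set} (P : A → Set) (Q : B → Set) (f : A → ℕ) (g : B → ℕ) →
  (∀ x → P x → Σ B λ y → Q y × g y ≤ f x) →
  (∀ y → Q y → Σ A λ x → P x × f x ≤ g y) →
  ∀ {C} → IsMinimumOn P f C → IsMinimumOn Q g C
minimum-transfer P Q f g to from (x , px , fx≡C , min) with to x px
... | y , qy , gy≤fx =
  y , qy , ≤-antisym (≤-trans gy≤fx (≤-reflexive fx≡C)) (min′ y qy) , min′
  where
  min′ : ∀ y → Q y → _ ≤ g y
  min′ y qy with from y qy
  ... | x′ , px′ , fx′≤gy = ≤-trans (min x′ px′) fx′≤gy

-- Walks in G

module Walks (N : Network) where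
  open Network N
  open import Data.List.Membership.DecPropositional (Fin._≟_ {n}) using (_∈?_)

  Joins-sym : ∀ {e a b} → Joins N e a b → Joins N e b a
  Joins-sym (inj₁ eq) = inj₂ eq
  Joins-sym (inj₂ eq) = inj₁ eq

  Joins-ends : ∀ {e a b u x} → Joins N e a b → Joins N e u x → (x ≡ b × u ≡ a) ⊎ (x ≡ a × u ≡ b)
  Joins-ends (inj₁ refl) (inj₁ eq) with Product.,-injective eq
  ... | refl , refl = inj₁ (refl , refl)
  Joins-ends (inj₁ refl) (inj₂ eq) with Product.,-injective eq
  ... | refl , refl = inj₂ (refl , refl)
  Joins-ends (inj₂ refl) (inj₁ eq) with Product.,-injective eq
  ... | refl , refl = inj₂ (refl , refl)
  Joins-ends (inj₂ refl) (inj₂ eq) with Product.,-injective eq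
  ... | refl , refl = inj₁ (refl , refl)

  Joins? : ∀ e u v → Dec (Joins N e u v)
  Joins? e u v = ends≟ (u , v) ⊎-dec ends≟ (v , u)
    where ends≟ = Product.≡-dec Fin._≟_ Fin._≟_ (ends e)

  _++ʷ_ : ∀ {F a b c} → Walk N F a b → Walk N F b c → Walk N F a c
  []             ++ʷ q = q
  step e e∈ j p  ++ʷ q = step e e∈ j (p ++ʷ q)

  reverseʷ : ∀ {F a b} → Walk N F a b → Walk N F b a
  reverseʷ p = go p []
    where
    go : ∀ {F a b c} → Walk N F a b → Walk N F a c → Walk N F b c
    go []              acc = acc
    go (step e e∈ j p) acc = go p (step e e∈ (Joins-sym j) acc)

  dropUntil : ∀ {F a v x} (p : Walk N F a v) → IsPath N p → x ∈ walkVerts N p → Σ (Walk N F x v) (IsPath N)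
  dropUntil []               u        (here refl) = [] , u
  dropUntil (step e e∈ j q)  u        (here refl) = step e e∈ j q , u
  dropUntil (step e e∈ j q)  (_ ∷ u)  (there x∈)  = dropUntil q u x∈

  toPath : ∀ {F a v} → Walk N F a v → Σ (Walk N F a v) (IsPath N)
  toPath []                          = [] , ([] ∷ [])
  toPath {a = a} (step e e∈ j q) with toPath q
  ... | q′ , q′-path with a ∈? walkVerts N q′
  ... | yes a∈ = dropUntil q′ q′-path a∈
  ... | no a∉  = step e e∈ j q′ , (¬Any⇒All¬ _ a∉ ∷ q′-path)

  NotFirstEdge : ∀ {F a b} → Fin m → Walk N F a b → Set
  NotFirstEdge g []             = ⊤
  NotFirstEdge g (step e _ _ _) = g ≢ e

  ∉-edges⇒NotFirstEdge : ∀ {F a b e} (p : Walk N F a b) → e ∉ walkEdges N p → walkEdges N p ≢ [] →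
    NotFirstEdge e p
  ∉-edges⇒NotFirstEdge []             _   p≢[] = ⊥-elim (p≢[] refl)
  ∉-edges⇒NotFirstEdge (step _ _ _ _) e∉p _    = e∉p ∘ here

  NonBacktracking : ∀ {F a b} → Walk N F a b → Set
  NonBacktracking []             = ⊤
  NonBacktracking (step e _ _ p) = NotFirstEdge e p × NonBacktracking p

  path⇒nonBacktracking : ∀ {F a b} (p : Walk N F a b) → IsPath N p → NonBacktracking p
  path⇒nonBacktracking []                                _ = tt
  path⇒nonBacktracking (step e e∈ j [])                   _ = tt , tt
  path⇒nonBacktracking (step e e∈ j (step e′ e′∈ j′ q)) ((_ ∷ a∉q) ∷ u) =
    (λ { refl → returns j′ }) , path⇒nonBacktracking (step e′ e′∈ j′ q) u
    where
    headAll : ∀ {F a b} {P : Fin n → Set} (p : Walk N F a b) → All P (walkVerts N p) → P a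
    headAll []             (pa ∷ _) = pa
    headAll (step _ _ _ _) (pa ∷ _) = pa
    returns : Joins N e _ _ → ⊥
    returns j″ with Joins-ends j j″
    ... | inj₁ (refl , refl) = headAll q a∉q refl
    ... | inj₂ (refl , _)    = headAll q a∉q refl

-- The tree of minimum-delay walks from r inside a set of edges U

module MinDelayTree (N : Network) (U : Subset (Network.m N)) (d-pos : ∀ e → 1 ≤ Network.d N e) where
  open Network N
  open Walks N

  data Reaches : Fin n → ℕ → Set where
    start : Reaches r 0
    ext   : ∀ {u v j} (e : Fin m) → e ∈ₛ U → Joins N e u v → Reaches u j → Reaches v (d e + j)

  Reaches-walk : ∀ {a v j} → Reaches a j → (p : Walk N U a v) → Reaches v (walkDelay N p + j)
  Reaches-walk ra []                       = ra
  Reaches-walk {j = j} ra (step e e∈ jn q) =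
    subst (Reaches _) (trans (sym (+-assoc (walkDelay N q) (d e) j)) (cong (_+ j) (+-comm (walkDelay N q) (d e))))
      (Reaches-walk (ext e e∈ jn ra) q)

  LastStep : Fin n → ℕ → Set
  LastStep v k = (v ≡ r × k ≡ 0)
               ⊎ (Σ (Fin m) λ e → Σ (Fin n) λ u → e ∈ₛ U × Joins N e u v × d e ≤ k × Reaches u (k ∸ d e))

  lastStep : ∀ {v k} → Reaches v k → LastStep v k
  lastStep start                      = inj₁ (refl , refl)
  lastStep (ext {u} {v} {j} e e∈ jn ru) =
    inj₂ (e , u , e∈ , jn , m≤m+n (d e) j , subst (Reaches u) (sym (m+n∸m≡n (d e) j)) ru)

  fromLastStep : ∀ {v k} → LastStep v k → Reaches v k
  fromLastStep (inj₁ (refl , refl))                = start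
  fromLastStep {v} (inj₂ (e , u , e∈ , jn , le , ru)) = subst (Reaches v) (m+[n∸m]≡n le) (ext e e∈ jn ru)

  -- The recursion is on k, which decreases because every edge has positive delay.
  Reaches? : ∀ v k → Dec (Reaches v k)
  Reaches? v k = <-rec (λ k → ∀ v → Dec (Reaches v k)) byLastStep k v
    where
    byLastStep : ∀ k → (∀ {j} → j < k → ∀ v → Dec (Reaches v j)) → ∀ v → Dec (Reaches v k)
    byLastStep k rec v = map′ fromLastStep lastStep
      ((v Fin.≟ r ×-dec k ≟ 0) ⊎-dec
       Fin.any? (λ e → Fin.any? (λ u → e Subset.∈? U ×-dec Joins? e u v ×-dec earlier e u)))
      where
      earlier : ∀ e u → Dec (d e ≤ k × Reaches u (k ∸ d e))
      earlier e u with d e ≤? k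
      ... | no  de≰k = no (λ x → de≰k (proj₁ x))
      ... | yes de≤k = map′ (de≤k ,_) proj₂ (rec (∸-monoʳ-< {k} {d e} {0} (d-pos e) de≤k) u)

  -- A reached vertex v ≠ r carries its least delay k ≤ D and the last edge e = uv of a walk
  -- realising it; e becomes the parent edge of v.
  data Status (v : Fin n) : Set where
    isRoot    : v ≡ r → Status v
    reached   : v ≢ r → (k : ℕ) → k ≤ D → (∀ j → j < k → ¬ Reaches v j) →
                (e : Fin m) (u : Fin n) (j : ℕ) → e ∈ₛ U → Joins N e u v → Reaches u j → k ≡ d e + j →
                Status v
    unreached : v ≢ r → (∀ j → j ≤ D → ¬ Reaches v j) → Status v

  -- Opaque: the definitions below abstract over `status v`, which must not unfold.
  opaque
    status : ∀ v → Status v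
    status v with v Fin.≟ r
    ... | yes v≡r = isRoot v≡r
    ... | no  v≢r with least-≤? (Reaches v) (Reaches? v) D
    ... | inj₂ none                    = unreached v≢r none
    ... | inj₁ (k , k≤D , rk , below) with lastStep rk
    ...   | inj₁ (v≡r , _)                  = ⊥-elim (v≢r v≡r)
    ...   | inj₂ (e , u , e∈ , jn , de≤k , ru) =
      reached v≢r k k≤D below e u (k ∸ d e) e∈ jn ru (sym (m+[n∸m]≡n de≤k))

  dist : Fin n → ℕ
  dist v with status v
  ... | isRoot _                          = 0
  ... | reached _ k _ _ _ _ _ _ _ _ _     = k
  ... | unreached _ _                     = 0

  parent : Fin n → Maybe (Fin m × Fin n)
  parent v with status v
  ... | isRoot _                          = nothing
  ... | reached _ _ _ _ e u _ _ _ _ _     = just (e , u)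
  ... | unreached _ _                     = nothing

  InTree : Fin n → Set
  InTree v with status v
  ... | unreached _ _ = ⊥
  ... | _             = ⊤

  InTree? : ∀ v → Dec (InTree v)
  InTree? v with status v
  ... | isRoot _                      = yes tt
  ... | reached _ _ _ _ _ _ _ _ _ _ _ = yes tt
  ... | unreached _ _                 = no (λ ())

  dist≤D : ∀ v → dist v ≤ D
  dist≤D v with status v
  ... | isRoot _                        = z≤n
  ... | reached _ _ k≤D _ _ _ _ _ _ _ _ = k≤D
  ... | unreached _ _                   = z≤n

  Reaches-dist : ∀ v → InTree v → Reaches v (dist v)
  Reaches-dist v _ with status v
  ... | isRoot refl                              = start
  ... | reached _ _ _ _ e _ _ e∈ jn ru refl      = ext e e∈ jn ru

  dist-least : ∀ v j → Reaches v j → j ≤ D → InTree v × dist v ≤ j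
  dist-least v j rj j≤D with status v
  ... | isRoot _                          = tt , z≤n
  ... | reached _ _ _ below _ _ _ _ _ _ _ = tt , ≮⇒≥ (λ j<k → below j j<k rj)
  ... | unreached _ none                  = ⊥-elim (none j j≤D rj)

  parent-r : parent r ≡ nothing
  parent-r with status r
  ... | isRoot _                          = refl
  ... | reached r≢r _ _ _ _ _ _ _ _ _ _   = ⊥-elim (r≢r refl)
  ... | unreached r≢r _                   = ⊥-elim (r≢r refl)

  dist-r : dist r ≡ 0
  dist-r with status r
  ... | isRoot _                          = refl
  ... | reached r≢r _ _ _ _ _ _ _ _ _ _   = ⊥-elim (r≢r refl)
  ... | unreached r≢r _                   = ⊥-elim (r≢r refl)

  InTree-r : InTree r
  InTree-r with status r
  ... | isRoot _                          = tt
  ... | reached r≢r _ _ _ _ _ _ _ _ _ _   = ⊥-elim (r≢r refl)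
  ... | unreached r≢r _                   = ⊥-elim (r≢r refl)

  record ParentEdge (v : Fin n) (e : Fin m) (u : Fin n) : Set where
    field
      joins     : Joins N e u v
      dist≡     : dist v ≡ d e + dist u
      parent-in : InTree u
      child-in  : InTree v
      edge∈U    : e ∈ₛ U
      child≢r   : v ≢ r

  -- Stated as a product (not as `ParentEdge`) so that abstracting over `status v` rewrites `dist v`.
  parentEdge-facts : ∀ v {e u} → parent v ≡ just (e , u) →
    Joins N e u v × dist v ≡ d e + dist u × InTree u × InTree v × e ∈ₛ U × v ≢ r
  parentEdge-facts v eq with status v
  parentEdge-facts v refl | reached v≢r k k≤D below e u j e∈ jn ru k≡ =
    jn , trans k≡ (cong (d e +_) (sym du≡j)) , u-in , tt , e∈ , v≢r
    where
    j≤D : j ≤ D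
    j≤D = ≤-trans (subst (j ≤_) (sym k≡) (m≤n+m j (d e))) k≤D
    u-in : InTree u
    u-in = proj₁ (dist-least u j ru j≤D)
    k≤ : k ≤ d e + dist u
    k≤ = ≮⇒≥ (λ lt → below _ lt (ext e e∈ jn (Reaches-dist u u-in)))
    du≡j : dist u ≡ j
    du≡j = ≤-antisym (proj₂ (dist-least u j ru j≤D))
                     (+-cancelˡ-≤ (d e) j (dist u) (subst (_≤ d e + dist u) k≡ k≤))

  parentEdge : ∀ v {e u} → parent v ≡ just (e , u) → ParentEdge v e u
  parentEdge v eq with parentEdge-facts v eq
  ... | jn , dist≡ , u-in , v-in , e∈ , v≢r = record
    { joins = jn ; dist≡ = dist≡ ; parent-in = u-in ; child-in = v-in ; edge∈U = e∈ ; child≢r = v≢r }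

  noParent⇒≡r : ∀ v → InTree v → parent v ≡ nothing → v ≡ r
  noParent⇒≡r v _ eq with status v
  noParent⇒≡r v _ eq  | isRoot v≡r                    = v≡r
  noParent⇒≡r v _ ()  | reached _ _ _ _ _ _ _ _ _ _ _

  ≢r⇒parent : ∀ v → InTree v → v ≢ r → Σ (Fin m) λ e → Σ (Fin n) λ u → parent v ≡ just (e , u)
  ≢r⇒parent v _ v≢r with status v
  ... | isRoot v≡r                        = ⊥-elim (v≢r v≡r)
  ... | reached _ _ _ _ e u _ _ _ _ _     = e , u , refl

  dist-parent< : ∀ {v e u} → parent v ≡ just (e , u) → dist u < dist v
  dist-parent< {v} {e} {u} eq =
    subst (dist u <_) (sym (ParentEdge.dist≡ (parentEdge v eq))) (m<n+m (dist u) (d-pos e))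

  dist-pos : ∀ v → InTree v → v ≢ r → 1 ≤ dist v
  dist-pos v v-in v≢r with ≢r⇒parent v v-in v≢r
  ... | _ , _ , eq = ≤-trans (s≤s z≤n) (dist-parent< eq)

  TerminalsReached : Set
  TerminalsReached = ∀ v → v ∈ₛ S → v ≢ r → Σ ℕ λ i → i ≤ D × Reaches v i

  IsParentEdge : Fin m → Fin n → Set
  IsParentEdge e v = Σ (Fin n) λ u → parent v ≡ just (e , u)

  IsParentEdge? : ∀ e v → Dec (IsParentEdge e v)
  IsParentEdge? e v with parent v
  ... | nothing = no (λ ())
  ... | just (e′ , u) with e′ Fin.≟ e
  ...   | yes refl = yes (u , refl)
  ...   | no  e′≢e = no (λ { (_ , refl) → e′≢e refl })

  treeEdges : Subset m
  treeEdges = subsetOf (λ e → Fin.any? (IsParentEdge? e))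

  treeVerts : Subset n
  treeVerts = subsetOf InTree?

  ∈-treeEdges⁺ : ∀ {v e u} → parent v ≡ just (e , u) → e ∈ₛ treeEdges
  ∈-treeEdges⁺ {v} {e} {u} eq = ∈-subsetOf⁺ (λ e → Fin.any? (IsParentEdge? e)) (v , u , eq)

  ∈-treeEdges⁻ : ∀ {e} → e ∈ₛ treeEdges → Σ (Fin n) (IsParentEdge e)
  ∈-treeEdges⁻ = ∈-subsetOf⁻ (λ e → Fin.any? (IsParentEdge? e))

  treeEdges⊆U : ∀ {e} → e ∈ₛ treeEdges → e ∈ₛ U
  treeEdges⊆U e∈ with ∈-treeEdges⁻ e∈
  ... | v , u , eq = ParentEdge.edge∈U (parentEdge v eq)

  treeEdge-orientation : ∀ {a b e} → e ∈ₛ treeEdges → Joins N e a b →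
    (parent b ≡ just (e , a) × dist b ≡ d e + dist a) ⊎ (parent a ≡ just (e , b) × dist a ≡ d e + dist b)
  treeEdge-orientation e∈ jn with ∈-treeEdges⁻ e∈
  ... | v , u , eq with Joins-ends jn (ParentEdge.joins (parentEdge v eq))
  ...   | inj₁ (refl , refl) = inj₁ (eq , ParentEdge.dist≡ (parentEdge v eq))
  ...   | inj₂ (refl , refl) = inj₂ (eq , ParentEdge.dist≡ (parentEdge v eq))

  dist-descending : ∀ {a y} (p : Walk N treeEdges a y) → NonBacktracking p →
    (∀ g w → parent a ≡ just (g , w) → NotFirstEdge g p) → dist y ≡ walkDelay N p + dist a
  dist-descending []               _          _       = refl
  dist-descending {a} (step e e∈ jn q) (nf , nb) notUp with treeEdge-orientation e∈ jn
  ... | inj₂ (pa , _)  = ⊥-elim (notUp e _ pa refl)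
  ... | inj₁ (pb , db) = begin
    dist _                               ≡⟨ dist-descending q nb notUp′ ⟩
    walkDelay N q + dist _               ≡⟨ cong (walkDelay N q +_) db ⟩
    walkDelay N q + (d e + dist a)       ≡⟨ +-assoc (walkDelay N q) (d e) (dist a) ⟨
    walkDelay N q + d e + dist a         ≡⟨ cong (_+ dist a) (+-comm (walkDelay N q) (d e)) ⟩
    d e + walkDelay N q + dist a         ∎
    where
    open ≡-Reasoning
    notUp′ : ∀ g w → parent _ ≡ just (g , w) → NotFirstEdge g q
    notUp′ g w pg with trans (sym pb) pg
    ... | refl = nf

  StartsUp : ∀ {a y} → Fin n → Walk N treeEdges a y → Fin m → Set
  StartsUp a []             f = Σ (Fin n) λ w → parent a ≡ just (f , w)
  StartsUp a (step e _ _ _) f = Σ (Fin n) λ w → parent a ≡ just (e , w)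

  dist-ascending : ∀ {a y} (p : Walk N treeEdges a y) → NonBacktracking p →
    ∀ f w → parent y ≡ just (f , w) → f ∉ walkEdges N p →
    dist a ≡ walkDelay N p + dist y × StartsUp a p f
  dist-ascending []                 _        f w pf _    = refl , (w , pf)
  dist-ascending {y = y} (step e e∈ jn q) (nf , nb) f w pf f∉
    with dist-ascending q nb f w pf (f∉ ∘ there) | treeEdge-orientation e∈ jn
  ... | ih , up | inj₁ (pb , _)  = ⊥-elim (twoParents q up pb nf f∉)
    where
    twoParents : ∀ {b y e a f} (q : Walk N treeEdges b y) → StartsUp b q f → parent b ≡ just (e , a) →
                 NotFirstEdge e q → f ∉ e ∷ walkEdges N q → ⊥
    twoParents []             (_ , pf) pb _  f∉ with trans (sym pb) pf
    ... | refl = f∉ (here refl)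
    twoParents (step _ _ _ _) (_ , pf) pb nf _  with trans (sym pb) pf
    ... | refl = nf refl
  ... | ih , _  | inj₂ (pa , da) =
    trans da (trans (cong (d e +_) ih) (sym (+-assoc (d e) (walkDelay N q) (dist y)))) , (_ , pa)

  treeEdges-acyclic : ¬ HasCycle N treeEdges
  treeEdges-acyclic (u , w , p , p-path , p≢[] , e , e∈ , jn , e∉p) with treeEdge-orientation e∈ jn
  ... | inj₁ (pu , du) = m≢n+m (dist u) (≤-trans (d-pos e) (m≤m+n (d e) _)) (begin
    dist u                        ≡⟨ du ⟩
    d e + dist w                  ≡⟨ cong (d e +_) (dist-descending p (path⇒nonBacktracking p p-path) notUp) ⟩
    d e + (walkDelay N p + dist u) ≡⟨ +-assoc (d e) _ _ ⟨
    d e + walkDelay N p + dist u  ∎)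
    where
    open ≡-Reasoning
    notUp : ∀ g x → parent u ≡ just (g , x) → NotFirstEdge g p
    notUp g x pu′ with trans (sym pu) pu′
    ... | refl = ∉-edges⇒NotFirstEdge p e∉p p≢[]
  ... | inj₂ (pw , dw) = m≢n+m (dist u) (≤-trans (d-pos e) (m≤n+m (d e) _)) (begin
    dist u                        ≡⟨ proj₁ (dist-ascending p (path⇒nonBacktracking p p-path) e u pw e∉p) ⟩
    walkDelay N p + dist w        ≡⟨ cong (walkDelay N p +_) dw ⟩
    walkDelay N p + (d e + dist u) ≡⟨ +-assoc (walkDelay N p) _ _ ⟨
    walkDelay N p + d e + dist u  ∎)
    where open ≡-Reasoning

  pathToRoot : ∀ v → InTree v → Walk N treeEdges v r
  pathToRoot v v-in = go (suc (dist v)) v ≤-refl v-in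
    where
    go : (fuel : ℕ) → ∀ v → dist v < fuel → InTree v → Walk N treeEdges v r
    go (suc t) v (s≤s dv≤t) v-in with parent v in eq
    ... | nothing     = subst (Walk N treeEdges v) (noParent⇒≡r v v-in eq) []
    ... | just (e , u) = step e (∈-treeEdges⁺ eq) (Joins-sym (ParentEdge.joins (parentEdge v eq)))
                              (go t u (<-≤-trans (dist-parent< eq) dv≤t) (ParentEdge.parent-in (parentEdge v eq)))

  steinerTree : TerminalsReached → SteinerTree N
  steinerTree terminals = record
    { W           = treeVerts
    ; F           = treeEdges
    ; edgesInside = inside
    ; connected   = λ u v u∈ v∈ → toPath (pathToRoot u (∈-subsetOf⁻ InTree? u∈)
                                           ++ʷ reverseʷ (pathToRoot v (∈-subsetOf⁻ InTree? v∈)))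
    ; acyclic     = treeEdges-acyclic
    ; spans       = spans
    }
    where
    inside : ∀ e → e ∈ₛ treeEdges → proj₁ (ends e) ∈ₛ treeVerts × proj₂ (ends e) ∈ₛ treeVerts
    inside e e∈ with ∈-treeEdges⁻ e∈
    ... | v , u , eq with ParentEdge.joins (parentEdge v eq)
    ...   | inj₁ ends≡ rewrite ends≡ = ∈-subsetOf⁺ InTree? (ParentEdge.parent-in (parentEdge v eq))
                                     , ∈-subsetOf⁺ InTree? (ParentEdge.child-in (parentEdge v eq))
    ...   | inj₂ ends≡ rewrite ends≡ = ∈-subsetOf⁺ InTree? (ParentEdge.child-in (parentEdge v eq))
                                     , ∈-subsetOf⁺ InTree? (ParentEdge.parent-in (parentEdge v eq))
    spans : ∀ v → v ∈ₛ S → v ∈ₛ treeVerts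
    spans v v∈S with v Fin.≟ r
    ... | yes refl = ∈-subsetOf⁺ InTree? InTree-r
    ... | no  v≢r with terminals v v∈S v≢r
    ...   | i , i≤D , ri = ∈-subsetOf⁺ InTree? (proj₁ (dist-least v i ri i≤D))

  steinerTree-delayBounded : ∀ terminals → DelayBounded N (steinerTree terminals)
  steinerTree-delayBounded _ v _ p p-path = subst (_≤ D) dist≡delay (dist≤D v)
    where
    notUp : ∀ g w → parent r ≡ just (g , w) → NotFirstEdge g p
    notUp g w pr with trans (sym parent-r) pr
    ... | ()
    dist≡delay : dist v ≡ walkDelay N p
    dist≡delay = trans (dist-descending p (path⇒nonBacktracking p p-path) notUp)
                       (trans (cong (walkDelay N p +_) dist-r) (+-identityʳ _))

  steinerTree-cost≤ : ∀ terminals → treeCost N (steinerTree terminals) ≤ Σsub c U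
  steinerTree-cost≤ _ = subst₂ _≤_ (sym (Σsub≡sum-members c treeEdges)) (sym (Σsub≡sum-members c U))
    (sum-map-≤-injection id c c (members treeEdges) (members U) (members-unique treeEdges)
      (λ e∈ → ∈ₛ⇒∈-members U (treeEdges⊆U (∈-members⇒∈ₛ treeEdges e∈))) (λ _ _ eq → eq) (λ _ → ≤-refl))

  copy : Fin n → HV N
  copy u with u Fin.≟ r
  ... | yes _ = root
  ... | no  _ = cp u (dist u)

  parentArcs : Fin n → List (HArc N)
  parentArcs v with parent v
  ... | nothing      = []
  ... | just (e , u) = [ (copy u , cp v (dist v) , c e) ]

  TreeTerminal : Fin n → Set
  TreeTerminal v = InTree v × v ∈ₛ S × v ≢ r

  TreeTerminal? : ∀ v → Dec (TreeTerminal v)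
  TreeTerminal? v = InTree? v ×-dec v Subset.∈? S ×-dec ¬? (v Fin.≟ r)

  terminalArcs : Fin n → List (HArc N)
  terminalArcs v with TreeTerminal? v
  ... | yes _ = [ (cp v (dist v) , tm v , 0) ]
  ... | no  _ = []

  arcsAt : Fin n → List (HArc N)
  arcsAt v = parentArcs v ++ terminalArcs v

  treeArcs : List (HArc N)
  treeArcs = concatMap arcsAt (allFin n)

  ∈-arcsAt⁻ : ∀ v {a} → a ∈ arcsAt v →
    (Σ (Fin m) λ e → Σ (Fin n) λ u → parent v ≡ just (e , u) × a ≡ (copy u , cp v (dist v) , c e))
    ⊎ (TreeTerminal v × a ≡ (cp v (dist v) , tm v , 0))
  ∈-arcsAt⁻ v a∈ with parent v | TreeTerminal? v
  ∈-arcsAt⁻ v (here refl)         | just (e , u) | _       = inj₁ (e , u , refl , refl)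
  ∈-arcsAt⁻ v (there (here refl)) | just _       | yes tv = inj₂ (tv , refl)
  ∈-arcsAt⁻ v (here refl)         | nothing      | yes tv = inj₂ (tv , refl)

  ∈-treeArcs⁻ : ∀ {a} → a ∈ treeArcs → Σ (Fin n) λ v → a ∈ arcsAt v
  ∈-treeArcs⁻ a∈ with find (∈-concatMap⁻ arcsAt {xs = allFin n} a∈)
  ... | v , _ , a∈v = v , a∈v

  arcsAt⊆treeArcs : ∀ {v a} → a ∈ arcsAt v → a ∈ treeArcs
  arcsAt⊆treeArcs {v} a∈ = ∈-concatMap⁺ arcsAt (lose (∈-allFin v) a∈)

  parentArc∈ : ∀ {v e u} → parent v ≡ just (e , u) → (copy u , cp v (dist v) , c e) ∈ treeArcs
  parentArc∈ {v} eq = arcsAt⊆treeArcs {v} (∈-++⁺ˡ (inParentArcs eq))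
    where
    inParentArcs : ∀ {e u} → parent v ≡ just (e , u) → (copy u , cp v (dist v) , c e) ∈ parentArcs v
    inParentArcs eq with parent v
    inParentArcs refl | just _ = here refl

  terminalArc∈ : ∀ {v} → TreeTerminal v → (cp v (dist v) , tm v , 0) ∈ treeArcs
  terminalArc∈ {v} tv = arcsAt⊆treeArcs {v} (∈-++⁺ʳ (parentArcs v) inTerminalArcs)
    where
    inTerminalArcs : (cp v (dist v) , tm v , 0) ∈ terminalArcs v
    inTerminalArcs with TreeTerminal? v
    ... | yes _   = here refl
    ... | no ¬tv = ⊥-elim (¬tv tv)

  parentArc-isArc : ∀ v e u → parent v ≡ just (e , u) → IsArc N (copy u , cp v (dist v) , c e)
  parentArc-isArc v e u eq with u Fin.≟ r
  ... | yes refl = subst (λ k → IsArc N (root , cp v k , c e)) (sym dv≡de) (rootArc e v (ParentEdge.joins P) de≤D)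
    where
    P = parentEdge v eq
    dv≡de : dist v ≡ d e
    dv≡de = trans (ParentEdge.dist≡ P) (trans (cong (d e +_) dist-r) (+-identityʳ _))
    de≤D : d e ≤ D
    de≤D = subst (_≤ D) dv≡de (dist≤D v)
  ... | no u≢r = subst (λ k → IsArc N (cp u (dist u) , cp v k , c e)) (sym (ParentEdge.dist≡ P))
    (edgeArc e u v (dist u) (ParentEdge.joins P) u≢r (ParentEdge.child≢r P)
      (dist-pos u (ParentEdge.parent-in P) u≢r)
      (subst (_≤ D) (trans (ParentEdge.dist≡ P) (+-comm (d e) (dist u))) (dist≤D v)))
    where P = parentEdge v eq

  treeArcs-areArcs : ∀ a → a ∈ treeArcs → IsArc N a
  treeArcs-areArcs a a∈ with ∈-treeArcs⁻ a∈
  ... | v , a∈v with ∈-arcsAt⁻ v a∈v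
  ...   | inj₁ (e , u , eq , refl)           = parentArc-isArc v e u eq
  ...   | inj₂ ((v-in , v∈S , v≢r) , refl) = termArc v (dist v) v∈S v≢r (dist-pos v v-in v≢r) (dist≤D v)

  root∉heads : root ∉ map (hd N) treeArcs
  root∉heads root∈ with ∈-map⁻ (hd N) root∈
  ... | a , a∈ , eq = headNotRoot (treeArcs-areArcs a a∈) (sym eq)
    where
    headNotRoot : ∀ {a} → IsArc N a → hd N a ≢ root
    headNotRoot (termArc _ _ _ _ _ _)     ()
    headNotRoot (edgeArc _ _ _ _ _ _ _ _ _) ()
    headNotRoot (rootArc _ _ _ _)         ()

  owner : HV N → Maybe (Fin n)
  owner root     = nothing
  owner (cp v _) = just v
  owner (tm v)   = just v

  heads-owned : ∀ {v x} → x ∈ map (hd N) (arcsAt v) → owner x ≡ just v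
  heads-owned {v} x∈ with ∈-map⁻ (hd N) x∈
  ... | a , a∈ , refl with ∈-arcsAt⁻ v a∈
  ...   | inj₁ (_ , _ , _ , refl) = refl
  ...   | inj₂ (_ , refl)         = refl

  heads-unique-at : ∀ v → Unique (map (hd N) (arcsAt v))
  heads-unique-at v with parent v | TreeTerminal? v
  ... | nothing | yes _ = [] ∷ []
  ... | nothing | no  _ = []
  ... | just _  | yes _ = ((λ ()) ∷ []) ∷ [] ∷ []
  ... | just _  | no  _ = [] ∷ []

  heads-unique : Unique (map (hd N) treeArcs)
  heads-unique = subst Unique (sym (map-concatMap (hd N) arcsAt (allFin n)))
    (concatMap-unique (map (hd N) ∘ arcsAt) (allFin n) (Unique.allFin⁺ n) heads-unique-at
      (λ x∈ x∈′ → just-injective (trans (sym (heads-owned x∈)) (heads-owned x∈′))))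

  Reach-copy : ∀ v → InTree v → Reach N treeArcs (copy v)
  Reach-copy v v-in = go (suc (dist v)) v ≤-refl v-in
    where
    go : (fuel : ℕ) → ∀ v → dist v < fuel → InTree v → Reach N treeArcs (copy v)
    go (suc t) v (s≤s dv≤t) v-in with v Fin.≟ r
    ... | yes _   = here
    ... | no v≢r with ≢r⇒parent v v-in v≢r
    ...   | _ , u , eq =
      there (go t u (<-≤-trans (dist-parent< eq) dv≤t) (ParentEdge.parent-in (parentEdge v eq))) (parentArc∈ eq)

  copy-≢r : ∀ {v} → v ≢ r → copy v ≡ cp v (dist v)
  copy-≢r {v} v≢r with v Fin.≟ r
  ... | yes v≡r = ⊥-elim (v≢r v≡r)
  ... | no  _   = refl

  Reach-treeArcs : ∀ a → a ∈ treeArcs → Reach N treeArcs (hd N a)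
  Reach-treeArcs a a∈ with ∈-treeArcs⁻ a∈
  ... | v , a∈v with ∈-arcsAt⁻ v a∈v
  ...   | inj₁ (e , u , eq , refl)       = subst (Reach N treeArcs) (copy-≢r (ParentEdge.child≢r P))
                                                 (Reach-copy v (ParentEdge.child-in P))
    where P = parentEdge v eq
  ...   | inj₂ ((v-in , _ , v≢r) , refl) =
    there (subst (Reach N treeArcs) (copy-≢r v≢r) (Reach-copy v v-in)) a∈

  dirSteinerTree : TerminalsReached → DirSteinerTree N
  dirSteinerTree terminals = record
    { arcs      = treeArcs
    ; areArcs   = treeArcs-areArcs
    ; rootIn0   = root∉heads
    ; inDeg1    = heads-unique
    ; reachable = Reach-treeArcs
    ; spans     = λ v v∈S v≢r → ∈-map⁺ (hd N) (terminalArc∈ (v-in v v∈S v≢r , v∈S , v≢r))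
    }
    where
    v-in : ∀ v → v ∈ₛ S → v ≢ r → InTree v
    v-in v v∈S v≢r with terminals v v∈S v≢r
    ... | i , i≤D , ri = proj₁ (dist-least v i ri i≤D)

  parentEdgeAt : Fin n → List (Fin m)
  parentEdgeAt v with parent v
  ... | nothing     = []
  ... | just (e , _) = [ e ]

  cost-arcsAt : ∀ v → sum (map (arcCost N) (arcsAt v)) ≡ sum (map c (parentEdgeAt v))
  cost-arcsAt v with parent v | TreeTerminal? v
  ... | nothing      | yes _ = refl
  ... | nothing      | no  _ = refl
  ... | just (_ , _) | yes _ = refl
  ... | just (_ , _) | no  _ = refl

  ∈-parentEdgeAt⁻ : ∀ {v e} → e ∈ parentEdgeAt v → IsParentEdge e v
  ∈-parentEdgeAt⁻ {v} e∈ with parent v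
  ∈-parentEdgeAt⁻ (here refl) | just (e , u) = u , refl

  parentEdgeAt-unique : ∀ v → Unique (parentEdgeAt v)
  parentEdgeAt-unique v with parent v
  ... | nothing = []
  ... | just _  = [] ∷ []

  -- Otherwise the two endpoints of e would be parents of each other.
  parentEdge-injective : ∀ {v v′ e u u′} → parent v ≡ just (e , u) → parent v′ ≡ just (e , u′) → v ≡ v′
  parentEdge-injective {v} {v′} {e} p p′ with Joins-ends (ParentEdge.joins (parentEdge v p))
                                                         (ParentEdge.joins (parentEdge v′ p′))
  ... | inj₁ (v′≡v , _)  = sym v′≡v
  ... | inj₂ (refl , refl) = ⊥-elim (m≢n+m (dist v) (≤-trans (d-pos e) (m≤m+n (d e) _)) (begin
    dist v              ≡⟨ ParentEdge.dist≡ (parentEdge v p) ⟩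
    d e + dist v′       ≡⟨ cong (d e +_) (ParentEdge.dist≡ (parentEdge v′ p′)) ⟩
    d e + (d e + dist v) ≡⟨ +-assoc (d e) (d e) _ ⟨
    d e + d e + dist v  ∎))
    where open ≡-Reasoning

  dirSteinerTree-cost≤ : ∀ terminals → dirCost N (dirSteinerTree terminals) ≤ Σsub c U
  dirSteinerTree-cost≤ _ = subst₂ _≤_ (sym cost≡) (sym (Σsub≡sum-members c U))
    (sum-map-≤-injection id c c (concatMap parentEdgeAt (allFin n)) (members U)
      (concatMap-unique parentEdgeAt (allFin n) (Unique.allFin⁺ n) parentEdgeAt-unique
        (λ e∈ e∈′ → parentEdge-injective (proj₂ (∈-parentEdgeAt⁻ e∈)) (proj₂ (∈-parentEdgeAt⁻ e∈′))))
      (λ e∈ → ∈ₛ⇒∈-members U (inU e∈)) (λ _ _ eq → eq) (λ _ → ≤-refl))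
    where
    cost≡ : sum (map (arcCost N) treeArcs) ≡ sum (map c (concatMap parentEdgeAt (allFin n)))
    cost≡ = begin
      sum (map (arcCost N) treeArcs)                                ≡⟨ sum-map-concatMap (arcCost N) arcsAt (allFin n) ⟩
      sum (map (λ v → sum (map (arcCost N) (arcsAt v))) (allFin n)) ≡⟨ cong sum (map-cong cost-arcsAt (allFin n)) ⟩
      sum (map (λ v → sum (map c (parentEdgeAt v))) (allFin n))     ≡⟨ sum-map-concatMap c parentEdgeAt (allFin n) ⟨
      sum (map c (concatMap parentEdgeAt (allFin n)))               ∎
      where open ≡-Reasoning
    inU : ∀ {e} → e ∈ concatMap parentEdgeAt (allFin n) → e ∈ₛ U
    inU e∈ with find (∈-concatMap⁻ parentEdgeAt {xs = allFin n} e∈)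
    ... | v , _ , e∈v = ParentEdge.edge∈U (parentEdge v (proj₂ (∈-parentEdgeAt⁻ e∈v)))

-- Steiner trees in G versus directed Steiner trees in H

delayBounded⇒dirSteinerTree : (N : Network) → Network.r N ∈ₛ Network.S N → (∀ e → 1 ≤ Network.d N e) →
  (T : SteinerTree N) → DelayBounded N T → Σ (DirSteinerTree N) λ T′ → dirCost N T′ ≤ treeCost N T
delayBounded⇒dirSteinerTree N r∈S d-pos T T-bounded =
  dirSteinerTree terminals , dirSteinerTree-cost≤ terminals
  where
  open Network N
  open SteinerTree T
  open MinDelayTree N F d-pos
  terminals : TerminalsReached
  terminals v v∈S _ with connected r v (spans r r∈S) (spans v v∈S)
  ... | p , p-path = walkDelay N p + 0 , subst (_≤ D) (sym (+-identityʳ _)) (T-bounded v v∈S p p-path)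
                   , Reaches-walk start p

module EdgeCopies (N : Network) where
  open Network N
  open Walks N

  CopyOf : Fin m → HArc N → Set
  CopyOf e (root , cp w j , k)   = Joins N e r w × j ≡ d e × k ≡ c e
  CopyOf e (cp u i , cp w j , k) = Joins N e u w × j ≡ d e + i × k ≡ c e
  CopyOf e _                     = ⊥

  CopyOf? : ∀ e a → Dec (CopyOf e a)
  CopyOf? e (root , cp w j , k)   = Joins? e r w ×-dec j ≟ d e ×-dec k ≟ c e
  CopyOf? e (cp u i , cp w j , k) = Joins? e u w ×-dec j ≟ d e + i ×-dec k ≟ c e
  CopyOf? e (root , root , _)     = no λ ()
  CopyOf? e (root , tm _ , _)     = no λ ()
  CopyOf? e (cp _ _ , root , _)   = no λ ()
  CopyOf? e (cp _ _ , tm _ , _)   = no λ ()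
  CopyOf? e (tm _ , _ , _)        = no λ ()

  CopyOf-unique : SimpleGraph N → ∀ {e e′} a → CopyOf e a → CopyOf e′ a → e ≡ e′
  CopyOf-unique (_ , simple) (root , cp w _ , _)   (j , _) (j′ , _) = simple _ _ r w j j′
  CopyOf-unique (_ , simple) (cp u _ , cp w _ , _) (j , _) (j′ , _) = simple _ _ u w j j′

  CopyOf-cost : ∀ {e} a → CopyOf e a → arcCost N a ≡ c e
  CopyOf-cost (root , cp _ _ , _)   (_ , _ , k≡) = k≡
  CopyOf-cost (cp _ _ , cp _ _ , _) (_ , _ , k≡) = k≡

dirSteinerTree⇒delayBounded : (N : Network) → SimpleGraph N → (∀ e → 1 ≤ Network.d N e) →
  (T : DirSteinerTree N) → Σ (SteinerTree N) λ T′ → DelayBounded N T′ × treeCost N T′ ≤ dirCost N T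
dirSteinerTree⇒delayBounded N simple d-pos T =
  steinerTree terminals , steinerTree-delayBounded terminals , ≤-trans (steinerTree-cost≤ terminals) Σc≤
  where
  open Network N
  open DirSteinerTree T
  open EdgeCopies N

  underlying : Subset m
  underlying = subsetOf (λ e → any? (CopyOf? e) arcs)

  open MinDelayTree N underlying d-pos

  -- Reaching v^i in H means reaching v with delay exactly i in G.
  Realised : HV N → Set
  Realised root     = ⊤
  Realised (cp v i) = Reaches v i
  Realised (tm v)   = Σ ℕ λ i → i ≤ D × Reaches v i

  realised : ∀ {x} → Reach N arcs x → Realised x
  realised here             = tt
  realised (there rx a∈) with areArcs _ a∈ | realised rx
  ... | termArc v i _ _ _ i≤D     | rv = i , i≤D , rv
  ... | edgeArc e u w i jn _ _ _ _ | ru = ext e (∈-subsetOf⁺ _ (lose a∈ (jn , refl , refl))) jn ru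
  ... | rootArc e w jn _          | _  =
    subst (Reaches w) (+-identityʳ (d e)) (ext e (∈-subsetOf⁺ _ (lose a∈ (jn , refl , refl))) jn start)

  terminals : TerminalsReached
  terminals v v∈S v≢r with ∈-map⁻ (hd N) (spans v v∈S v≢r)
  ... | a , a∈ , eq = subst Realised (sym eq) (realised (reachable a a∈))

  -- The fallback in the `no` case is never used: `arcOf` is applied to underlying edges only.
  arcOf : Fin m → HArc N
  arcOf e with any? (CopyOf? e) arcs
  ... | yes c∈ = proj₁ (find c∈)
  ... | no  _  = root , root , 0

  arcOf-spec : ∀ {e} → e ∈ₛ underlying → arcOf e ∈ arcs × CopyOf e (arcOf e)
  arcOf-spec {e} e∈ with any? (CopyOf? e) arcs | ∈-subsetOf⁻ _ e∈
  ... | yes c∈ | _  = proj₂ (find c∈)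
  ... | no ¬c∈ | c∈ = ⊥-elim (¬c∈ c∈)

  Σc≤ : Σsub c underlying ≤ dirCost N T
  Σc≤ = subst (_≤ dirCost N T) (sym (Σsub≡sum-members c underlying))
    (sum-map-≤-injection arcOf c (arcCost N) (members underlying) arcs (members-unique underlying)
      (λ e∈ → proj₁ (spec e∈))
      (λ e∈ e′∈ eq → CopyOf-unique simple (arcOf _) (proj₂ (spec e∈)) (subst (CopyOf _) (sym eq) (proj₂ (spec e′∈))))
      (λ e∈ → ≤-reflexive (sym (CopyOf-cost (arcOf _) (proj₂ (spec e∈))))))
    where
    spec : ∀ {e} → e ∈ members underlying → arcOf e ∈ arcs × CopyOf e (arcOf e)
    spec e∈ = arcOf-spec (∈-members⇒∈ₛ underlying e∈)

theorem4 : (N : Network) → SimpleGraph N → Network.r N ∈ₛ Network.S N →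
    (∀ e → 1 ≤ Network.c N e) → (∀ e → 1 ≤ Network.d N e) → 1 ≤ Network.D N →
    ∀ (C : ℕ) → (MinDirSteinerCost N C → MinDelayBoundedSteinerCost N C)
                × (MinDelayBoundedSteinerCost N C → MinDirSteinerCost N C)
theorem4 N simple r∈S _ d-pos _ C =
    (λ minH → minimum-transfer Unrestricted (DelayBounded N) (dirCost N) (treeCost N) toG toH (fromMinDir minH))
  , (λ minG → toMinDir (minimum-transfer (DelayBounded N) Unrestricted (treeCost N) (dirCost N) toH toG minG))
  where
  Unrestricted : DirSteinerTree N → Set
  Unrestricted _ = ⊤
  toG : ∀ T → Unrestricted T → Σ (SteinerTree N) λ T′ → DelayBounded N T′ × treeCost N T′ ≤ dirCost N T
  toG T _ = dirSteinerTree⇒delayBounded N simple d-pos T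
  toH : ∀ T → DelayBounded N T → Σ (DirSteinerTree N) λ T′ → Unrestricted T′ × dirCost N T′ ≤ treeCost N T
  toH T bounded with delayBounded⇒dirSteinerTree N r∈S d-pos T bounded
  ... | T′ , le = T′ , tt , le
  fromMinDir : MinDirSteinerCost N C → IsMinimumOn Unrestricted (dirCost N) C
  fromMinDir (T , eq , min) = T , tt , eq , λ T′ _ → min T′
  toMinDir : IsMinimumOn Unrestricted (dirCost N) C → MinDirSteinerCost N C
  toMinDir (T , _ , eq , min) = T , eq , λ T′ → min T′ tt
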